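{- For every $k\in\{1,2\}$, set of formulas $\Gamma$, and formula $\varphi$: $\Gamma\vDash_k\varphi \Rightarrow \Gamma\vdash_k\varphi$.
   Context: Formulas are built from a countable set $PL$ of propositional letters and $\bot$ using $\land,\lor,\to$; $\neg\alpha:=\alpha\to\bot$, $\top:=\bot\to\bot$. For a frame $\mathfrak F=\langle W,R\rangle$, $X\subseteq W$: $\Box_{\mathfrak F}X=\{w\mid\forall v(wRv\Rightarrow v\in X)\}$, $\Diamond_{\mathfrak F}X=W\setminus\Box_{\mathfrak F}(W\setminus X)$, $\Diamond^{ -1}_{\mathfrak F}X=\{w\mid\exists x\in X,\ xRw\}$; $FP_{\mathfrak F}=\{\Box_{\mathfrak F}X\mid X\subseteq W\}$. A $\Box\Diamond^{ -1}$-model is a Kripke model with $V(p)\in FP_{\mathfrak F}$ for all $p$. Truth sets: $\|p\|=V(p)$, $\|\bot\|=\Box_{\mathfrak F}\emptyset$, $\|\alpha\land\beta\|=\|\alpha\|\cap\|\beta\|$, $\|\alpha\to\beta\|=\Box_{\mathfrak F}((W\setminus\|\alpha\|)\cup\|\beta\|)$, $\|\alpha\lor\beta\|=\Box_{\mathfrak F}\Diamond^{ -1}_{\mathfrak F}(\|\alpha\|\cup\|\beta\|)$. A frame is pseudo-reflexive iff every $w\in\Box_{\mathfrak F}\emptyset\cup\Diamond_{\mathfrak F}\Box_{\mathfrak F}\Diamond^{ -1}_{\mathfrak F}\{w\}$, and pseudo-symmetric iff every $w\in\Box_{\mathfrak F}\Diamond_{\mathfrak F}\Box_{\mathfrak F}\Diamond^{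 -1}_{\mathfrak F}\{w\}$. $\mathcal D_1$ = pseudo-reflexive pseudo-symmetric $\Box\Diamond^{ -1}$-models; $\mathcal D_2$ = reflexive pseudo-symmetric $\Box\Diamond^{ -1}$-models; $\Gamma\vDash_k\varphi$ iff for every $\mathfrak M\in\mathcal D_k$ and $w$, $\mathfrak M,w\vDash\Gamma$ implies $\mathfrak M,w\vDash\varphi$. Syntax: relations $\vdash\subseteq Form\times Form$, extended to sets by $\Gamma\vdash\alpha$ iff $\bigwedge\Gamma_0\vdash\alpha$ for some finite $\Gamma_0\subseteq\Gamma$ ($\bigwedge\emptyset=\top$); "$\vdash\alpha$" means $\chi\vdash\alpha$ for all $\chi$. Basic rules: (A) $\alpha\vdash\alpha$; (Cut) $\alpha\vdash\beta,\beta\vdash\gamma\Rightarrow\alpha\vdash\gamma$; ($\bot$) $\bot\vdash\alpha$; ($\land$R) $\chi\vdash\alpha,\chi\vdash\beta\Rightarrow\chi\vdash\alpha\land\beta$; ($\land$L) $\alpha\land\beta\vdash\alpha$, $\alpha\land\beta\vdash\beta$; ($\lor$R) $\alpha\vdash\alpha\lor\beta$, $\beta\vdash\alpha\lor\beta$; ($\lor$L) $\alpha\vdash\chi,\beta\vdash\chi\Rightarrow\alpha\lor\beta\vdash\chi$; (DT$_0$) $\alpha\vdash\beta\Rightarrow\ \vdash\alpha\to\beta$; ($\to\land$) $(\alpha\to\beta)\land(\alpha\to\gamma)\vdash\alpha\to\beta\land\gamma$; ($\to$tr) $(\alpha\to\beta)\land(\beta\to\gamma)\vdash\alpha\to\gamma$;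 ($\to$-$\lor$.s) for $n\ge1$, $\bigvee_j(\alpha_j\to\beta_j)\land\bigwedge_j(\psi_j\land\beta_j\to\chi)\vdash\bigwedge_j(\psi_j\land\alpha_j)\to\chi$. Further rules: (Abs) $\alpha\land\neg\alpha\vdash\bot$; ($\neg\neg$I) $\alpha\vdash\neg\neg\alpha$; (Refl$_1$) if $\psi_j\land\beta_j\vdash\chi$ for all $1\le j\le n$ then $\bigwedge_j(\psi_j\land\alpha_j)\land\bigvee_j(\alpha_j\to\beta_j)\vdash\chi$; (Refl$_2$) $\bigwedge_j(\psi_j\land\beta_j\to\chi)\vdash\bigwedge_j(\psi_j\land\alpha_j)\land\bigvee_j(\alpha_j\to\beta_j)\to\chi$. i-formulas: expressions $\Delta\sqsupset\Theta$ with $\Delta,\Theta$ non-empty finite sets of formulas. $\Vdash_1\subseteq\wp(Form^i)\times Form^i$ is the least relation satisfying: (A) $\Gamma^i\cup\{\alpha^i\}\Vdash\alpha^i$; (Cut) $\Gamma^i\Vdash\alpha^i$ and $\Phi^i\cup\{\alpha^i\}\Vdash\beta^i$ imply $\Gamma^i\cup\Phi^i\Vdash\beta^i$; (i-A) $\Delta\cap\Theta\neq\emptyset\Rightarrow\ \Vdash\Delta\sqsupset\Theta$; (i-Cut) $\{\Delta_1\sqsupset\Theta_1\cup\{\varphi\},\Delta_2\cup\{\varphi\}\sqsupset\Theta_2\}\Vdash\Delta_1\cup\Delta_2\sqsupset\Theta_1\cup\Theta_2$; (i-$\land$L) $\Vdash\{\varphi\land\psi\}\sqsupset\{\varphi\}$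 and $\Vdash\{\varphi\land\psi\}\sqsupset\{\psi\}$; (i-$\land$R) $\Vdash\{\varphi,\psi\}\sqsupset\{\varphi\land\psi\}$. For a formula $\gamma$, $\Vdash^\gamma_2$ is the least such relation also satisfying ($\gamma$-Refl) $\Vdash\{\varphi_1,\dots,\varphi_n,\bigvee_j(\varphi_j\to\psi_j)\lor\gamma\}\sqsupset\{\psi_1,\dots,\psi_n\}$. Let $i_\gamma(\Gamma)=\{\{\varphi_1,\dots,\varphi_n\}\sqsupset\{\psi_1,\dots,\psi_n\}\mid\bigvee_j(\varphi_j\to\psi_j)\lor\gamma\in\Gamma\}$ and $Th_{\vdash}(\alpha)=\{\varphi\mid\alpha\vdash\varphi\}$. $\vdash_1$ is the smallest $\vdash$ satisfying the basic rules, (Abs), ($\neg\neg$I) and (Prop$_1$): $i_\gamma(Th_\vdash(\alpha))\Vdash_1\{\top\}\sqsupset\{\bot\}\Rightarrow\alpha\vdash\gamma$. $\vdash_2$ is the smallest $\vdash$ satisfying the basic rules, ($\neg\neg$I), (Refl$_1$), (Refl$_2$) and (Prop$_2$): $i_\gamma(Th_\vdash(\alpha))\Vdash^\gamma_2\{\top\}\sqsupset\{\bot\}\Rightarrow\alpha\vdash\gamma$. -}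

module Defs where

open import Level using (0ℓ)
open import Data.Nat using (ℕ)
open import Data.Product using (Σ; ∃; _×_; _,_; proj₁; proj₂)
open import Data.Sum using (_⊎_)
open import Data.Empty using (⊥)
open import Data.List using (List; []; _∷_)
open import Data.List.NonEmpty as L⁺ using (List⁺; _∷_; [_]; toList; _⁺++_; _++⁺_)
open import Data.List.Membership.Propositional using (_∈_)
open import Data.List.Relation.Unary.All using (All)
open import Relation.Binary.PropositionalEquality using (_≡_)
open import Relation.Nullary using (¬_)
open import Function.Bundles using (_⇔_)

infixr 7 _∧ᶠ_
infixr 6 _∨ᶠ_
infixr 5 _⇒_

data Form : Set where
  fvar : ℕ → Form
  fbot : Form
  _∧ᶠ_ : Form → Form → Form
  _∨ᶠ_ : Form → Form → Form
  _⇒_  : Form → Form → Form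

¬ᶠ_ : Form → Form
¬ᶠ α = α ⇒ fbot

⊤ᶠ : Form
⊤ᶠ = fbot ⇒ fbot

⋀ : List Form → Form
⋀ []          = ⊤ᶠ
⋀ (a ∷ [])    = a
⋀ (a ∷ b ∷ l) = a ∧ᶠ ⋀ (b ∷ l)

⋀⁺ : List⁺ Form → Form
⋀⁺ l = ⋀ (toList l)

⋁ᵃ : Form → List Form → Form
⋁ᵃ a []      = a
⋁ᵃ a (b ∷ l) = a ∨ᶠ ⋁ᵃ b l

⋁⁺ : List⁺ Form → Form
⋁⁺ (a ∷ l) = ⋁ᵃ a l

Subset : Set → Set₁
Subset W = W → Set

module FrameOps {W : Set} (R : W → W → Set) where

  □ : Subset W → Subset W
  □ X w = ∀ v → R w v → X v

  ∁ : Subset W → Subset W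
  ∁ X w = ¬ X w

  ◇ : Subset W → Subset W
  ◇ X = ∁ (□ (∁ X))

  ◇⁻¹ : Subset W → Subset W
  ◇⁻¹ X w = ∃ λ x → X x × R x w

  ∅ : Subset W
  ∅ _ = ⊥

  _∪_ : Subset W → Subset W → Subset W
  (X ∪ Y) w = X w ⊎ Y w

  _∩_ : Subset W → Subset W → Subset W
  (X ∩ Y) w = X w × Y w

  ｛_｝ : W → Subset W
  ｛ w ｝ x = x ≡ w

  InFP : Subset W → Set₁
  InFP X = Σ (Subset W) λ Y → ∀ w → X w ⇔ □ Y w

  Reflexive : Set
  Reflexive = ∀ w → R w w

  PseudoReflexive : Set
  PseudoReflexive = ∀ w → (□ ∅ ∪ ◇ (□ (◇⁻¹ ｛ w ｝))) w

  PseudoSymmetric : Set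
  PseudoSymmetric = ∀ w → □ (◇ (□ (◇⁻¹ ｛ w ｝))) w

record Model : Set₁ where
  field
    W    : Set
    R    : W → W → Set
    V    : ℕ → Subset W
    V-FP : ∀ p → FrameOps.InFP R (V p)

module _ (M : Model) where
  open Model M
  open FrameOps R

  ‖_‖ : Form → Subset W
  ‖ fvar p ‖  = V p
  ‖ fbot ‖    = □ ∅
  ‖ α ∧ᶠ β ‖ = ‖ α ‖ ∩ ‖ β ‖
  ‖ α ⇒ β ‖  = □ (∁ ‖ α ‖ ∪ ‖ β ‖)
  ‖ α ∨ᶠ β ‖ = □ (◇⁻¹ (‖ α ‖ ∪ ‖ β ‖))

data K : Set where
  k₁ k₂ : K

InClass : K → Model → Set
InClass k₁ M = FrameOps.PseudoReflexive (Model.R M) × FrameOps.PseudoSymmetric (Model.R M)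
InClass k₂ M = FrameOps.Reflexive (Model.R M) × FrameOps.PseudoSymmetric (Model.R M)

_⊨[_]_ : (Form → Set) → K → Form → Set₁
Γ ⊨[ k ] φ = (M : Model) → InClass k M → (w : Model.W M) →
             (∀ γ → Γ γ → ‖ M ‖ γ w) → ‖ M ‖ φ w

-- i-formulas  Δ ⊐ Θ  (Δ, Θ non-empty finite sets, given by lists;
-- lists with the same elements denote the same i-formula)

infix 4 _⊐_
record IForm : Set where
  constructor _⊐_
  field
    ante : List⁺ Form
    succ : List⁺ Form

_≋_ : List⁺ Form → List⁺ Form → Set
A ≋ B = ∀ x → (x ∈ toList A) ⇔ (x ∈ toList B)

_≈ᵢ_ : IForm → IForm → Set
(Δ ⊐ Θ) ≈ᵢ (Δ' ⊐ Θ') = (Δ ≋ Δ') × (Θ ≋ Θ')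

-- Der Ax Γ β : β is derivable from the set Γ of i-formulas in the least
-- consequence relation satisfying (A),(Cut),(i-A),(i-Cut),(i-∧L),(i-∧R)
-- and the extra axioms Ax.
data Der (Ax : IForm → Set) (Γ : IForm → Set) : IForm → Set where
  hyp   : ∀ {β} → Γ β → Der Ax Γ β
  ax    : ∀ {β} → Ax β → Der Ax Γ β
  resp  : ∀ {β β'} → β ≈ᵢ β' → Der Ax Γ β → Der Ax Γ β'
  i-A   : ∀ Δ Θ → (∃ λ x → x ∈ toList Δ × x ∈ toList Θ) → Der Ax Γ (Δ ⊐ Θ)
  i-Cut : ∀ (Δ₁ : List⁺ Form) (Θ₁ Δ₂ : List Form) (Θ₂ : List⁺ Form) φ →
          Der Ax Γ (Δ₁ ⊐ (φ ∷ Θ₁)) → Der Ax Γ ((φ ∷ Δ₂) ⊐ Θ₂) →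
          Der Ax Γ ((Δ₁ ⁺++ Δ₂) ⊐ (Θ₁ ++⁺ Θ₂))
  i-∧L₁ : ∀ φ ψ → Der Ax Γ ([ φ ∧ᶠ ψ ] ⊐ [ φ ])
  i-∧L₂ : ∀ φ ψ → Der Ax Γ ([ φ ∧ᶠ ψ ] ⊐ [ ψ ])
  i-∧R  : ∀ φ ψ → Der Ax Γ ((φ ∷ ψ ∷ []) ⊐ [ φ ∧ᶠ ψ ])

impl : Form × Form → Form
impl (φ , ψ) = φ ⇒ ψ

NoAx : IForm → Set
NoAx _ = ⊥

data γRefl (γ : Form) : IForm → Set where
  mk : (ps : List⁺ (Form × Form)) →
       γRefl γ (((⋁⁺ (L⁺.map impl ps) ∨ᶠ γ) ∷ toList (L⁺.map proj₁ ps)) ⊐ L⁺.map proj₂ ps)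

iγ : Form → (Form → Set) → IForm → Set
iγ γ Γ ι = Σ (List⁺ (Form × Form)) λ ps →
             Γ (⋁⁺ (L⁺.map impl ps) ∨ᶠ γ) × (ι ≡ (L⁺.map proj₁ ps ⊐ L⁺.map proj₂ ps))

⊤⊐⊥ : IForm
⊤⊐⊥ = [ ⊤ᶠ ] ⊐ [ fbot ]

Tri : Set
Tri = Form × Form × Form

tα tβ tψ : Tri → Form
tα (a , b , p) = a
tβ (a , b , p) = b
tψ (a , b , p) = p

infix 3 _⊢[_]_
data _⊢[_]_ : Form → K → Form → Set where
  A     : ∀ {k} α → α ⊢[ k ] α
  Cut   : ∀ {k α β γ} → α ⊢[ k ] β → β ⊢[ k ] γ → α ⊢[ k ] γ
  ⊥L    : ∀ {k} α → fbot ⊢[ k ] α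
  ∧R    : ∀ {k χ α β} → χ ⊢[ k ] α → χ ⊢[ k ] β → χ ⊢[ k ] α ∧ᶠ β
  ∧L₁   : ∀ {k} α β → α ∧ᶠ β ⊢[ k ] α
  ∧L₂   : ∀ {k} α β → α ∧ᶠ β ⊢[ k ] β
  ∨R₁   : ∀ {k} α β → α ⊢[ k ] α ∨ᶠ β
  ∨R₂   : ∀ {k} α β → β ⊢[ k ] α ∨ᶠ β
  ∨L    : ∀ {k α β χ} → α ⊢[ k ] χ → β ⊢[ k ] χ → α ∨ᶠ β ⊢[ k ] χ
  DT₀   : ∀ {k α β} → α ⊢[ k ] β → ∀ χ → χ ⊢[ k ] α ⇒ β
  ⇒∧    : ∀ {k} α β γ → (α ⇒ β) ∧ᶠ (α ⇒ γ) ⊢[ k ] α ⇒ β ∧ᶠ γ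
  ⇒tr   : ∀ {k} α β γ → (α ⇒ β) ∧ᶠ (β ⇒ γ) ⊢[ k ] α ⇒ γ
  ⇒∨s   : ∀ {k} (ts : List⁺ Tri) χ →
          ⋁⁺ (L⁺.map (λ t → tα t ⇒ tβ t) ts) ∧ᶠ ⋀⁺ (L⁺.map (λ t → tψ t ∧ᶠ tβ t ⇒ χ) ts)
            ⊢[ k ] ⋀⁺ (L⁺.map (λ t → tψ t ∧ᶠ tα t) ts) ⇒ χ
  ¬¬I   : ∀ {k} α → α ⊢[ k ] ¬ᶠ ¬ᶠ α
  Abs   : ∀ α → α ∧ᶠ ¬ᶠ α ⊢[ k₁ ] fbot
  Refl₁ : ∀ (ts : List⁺ Tri) χ →
          (∀ t → t ∈ toList ts → tψ t ∧ᶠ tβ t ⊢[ k₂ ] χ) →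
          ⋀⁺ (L⁺.map (λ t → tψ t ∧ᶠ tα t) ts) ∧ᶠ ⋁⁺ (L⁺.map (λ t → tα t ⇒ tβ t) ts) ⊢[ k₂ ] χ
  Refl₂ : ∀ (ts : List⁺ Tri) χ →
          ⋀⁺ (L⁺.map (λ t → tψ t ∧ᶠ tβ t ⇒ χ) ts)
            ⊢[ k₂ ] (⋀⁺ (L⁺.map (λ t → tψ t ∧ᶠ tα t) ts) ∧ᶠ ⋁⁺ (L⁺.map (λ t → tα t ⇒ tβ t) ts)) ⇒ χ
  Prop₁ : ∀ α γ → Der NoAx (iγ γ (λ φ → α ⊢[ k₁ ] φ)) ⊤⊐⊥ → α ⊢[ k₁ ] γ
  Prop₂ : ∀ α γ → Der (γRefl γ) (iγ γ (λ φ → α ⊢[ k₂ ] φ)) ⊤⊐⊥ → α ⊢[ k₂ ] γ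

_⊢ˢ[_]_ : (Form → Set) → K → Form → Set
Γ ⊢ˢ[ k ] α = Σ (List Form) λ Γ₀ → All Γ Γ₀ × (⋀ Γ₀ ⊢[ k ] α)

-- Completeness by a canonical model. A world is a consistent ⊢ₖ-theory w together with a formula γ_w
-- such that the (γ_w-Refl) i-formulas hold in w, and w R v iff every i-formula of i_{γ_v}(w) holds in v.
-- All worlds needed are Lindenbaum extensions of underivable i-formulas; underivability is certified by
-- an invariant of i-derivations, parametrised by a downward closed set J of "refuted" formulas and a
-- filter T. (Prop_k), applied after collecting the finitely many premises used from w into one formula,
-- gives for φ ∉ w a successor of w that no world containing φ sees; this yields V(p) ∈ FP and the
-- cases ⊥ and ∨ of the truth lemma ‖φ‖ w ⇔ φ ∈ w. The frame conditions come from (¬¬I), (Abs) and,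
-- for 𝒟₂, the (γ-Refl) axioms stored in every world.

{-# OPTIONS --safe #-}
module Submission where

open import Defs
open import Level using (0ℓ)
open import Axiom.ExcludedMiddle using (ExcludedMiddle)
open import Axiom.DoubleNegationElimination using (DoubleNegationElimination; em⇒dne)
open import Data.Nat using (ℕ; zero; suc; _≤_; _⊔_; z≤n; _≤′_; ≤′-refl; ≤′-step)
open import Data.Nat.Properties using (m≤m⊔n; m≤n⊔m; ≤⇒≤′)
open import Data.Product using (Σ; ∃; ∃₂; _×_; _,_; proj₁; proj₂)
open import Data.Sum using (_⊎_; inj₁; inj₂; [_,_]′)
open import Data.Empty using (⊥; ⊥-elim)
open import Data.List as List using (List; []; _∷_; _++_; cartesianProductWith)
import Data.List.NonEmpty.Properties as L⁺
open import Data.List.NonEmpty as L⁺ using (List⁺; _∷_; [_]; toList; _⁺++_; _++⁺_; _∷⁺_; _⁺++⁺_)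
open import Data.List.Membership.Propositional using (_∈_)
open import Data.List.Membership.Propositional.Properties
  using (∈-map⁺; ∈-map⁻; ∈-++⁺ˡ; ∈-++⁺ʳ; ∈-++⁻; ∈-cartesianProductWith⁺)
open import Data.List.Relation.Binary.Subset.Propositional using (_⊆_)
open import Data.List.Relation.Binary.Subset.Propositional.Properties
  using (map⁺; xs⊆xs++ys; xs⊆ys++xs)
open import Data.List.Relation.Unary.Any using (here; there)
import Data.List.Relation.Unary.All as All
import Data.List.Relation.Unary.All.Properties as All
open import Relation.Binary.PropositionalEquality using (_≡_; refl; sym; trans; cong; cong₂; subst; subst₂)
open import Relation.Nullary using (¬_; yes; no)
open import Relation.Nullary.Decidable using (isYes; toWitness; fromWitness)
import Data.Bool as Bool
open Bool using (Bool)
open import Function.Base using (id; _∘_)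
open import Function.Bundles using (_⇔_; mk⇔; Equivalence)

++-⊆ : ∀ {A : Set} {xs ys zs : List A} → xs ⊆ zs → ys ⊆ zs → xs ++ ys ⊆ zs
++-⊆ {xs = xs} xs⊆ ys⊆ x∈ = [ xs⊆ , ys⊆ ]′ (∈-++⁻ xs x∈)

toList-++⁺ : ∀ {A : Set} (xs : List A) (ys : List⁺ A) → toList (xs ++⁺ ys) ≡ xs ++ toList ys
toList-++⁺ []       ys = refl
toList-++⁺ (x ∷ xs) ys = cong (x ∷_) (toList-++⁺ xs ys)

++⁺-⊆ : ∀ {A : Set} {xs : List A} {ys zs : List⁺ A} → xs ⊆ toList zs → toList ys ⊆ toList zs →
        toList (xs ++⁺ ys) ⊆ toList zs
++⁺-⊆ {xs = xs} {ys} xs⊆ ys⊆ = ++-⊆ xs⊆ ys⊆ ∘ subst (_ ∈_) (toList-++⁺ xs ys)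

⊆-++⁺ˡ : ∀ {A : Set} (xs : List A) (ys : List⁺ A) → xs ⊆ toList (xs ++⁺ ys)
⊆-++⁺ˡ xs ys = subst (_ ∈_) (sym (toList-++⁺ xs ys)) ∘ xs⊆xs++ys xs (toList ys)

⊆-++⁺ʳ : ∀ {A : Set} (xs : List A) (ys : List⁺ A) → toList ys ⊆ toList (xs ++⁺ ys)
⊆-++⁺ʳ xs ys = subst (_ ∈_) (sym (toList-++⁺ xs ys)) ∘ xs⊆ys++xs (toList ys) xs

map-factor : ∀ {A B C D : Set} {f : C → D} {u : A → C} {g : B → D} {h : A → B} →
             (∀ x → f (u x) ≡ g (h x)) → ∀ xs → L⁺.map f (L⁺.map u xs) ≡ L⁺.map g (L⁺.map h xs)
map-factor eq xs = trans (sym (L⁺.map-∘ xs)) (trans (L⁺.map-cong eq xs) (L⁺.map-∘ xs))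

map-∀ : ∀ {A B : Set} (P : B → Set) (f : A → B) (xs : List A) →
        (∀ {x} → x ∈ xs → P (f x)) → ∀ {y} → y ∈ List.map f xs → P y
map-∀ P f xs h y∈ with ∈-map⁻ f y∈
... | x , x∈ , refl = h x∈

eventually-all : ∀ {A : Set} (P : ℕ → A → Set) → (∀ {m n x} → m ≤ n → P m x → P n x) →
                 ∀ (L : List A) → (∀ {x} → x ∈ L → ∃ λ n → P n x) → ∃ λ N → ∀ {x} → x ∈ L → P N x
eventually-all P mono []      h = 0 , λ ()
eventually-all P mono (x ∷ L) h with h (here refl) | eventually-all P mono L (h ∘ there)
... | m , Px | n , PL = m ⊔ n , λ { (here refl) → mono (m≤m⊔n m n) Px ; (there x∈) → mono (m≤n⊔m m n) (PL x∈) }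

module Derived (k : K) where

  infix 3 _⊢_
  _⊢_ : Form → Form → Set
  α ⊢ β = α ⊢[ k ] β

  infixr 4 _∙_
  _∙_ : ∀ {α β γ} → α ⊢ β → β ⊢ γ → α ⊢ γ
  _∙_ = Cut

  ⊢⊤ : ∀ χ → χ ⊢ ⊤ᶠ
  ⊢⊤ = DT₀ (A fbot)

  π₁ : ∀ {α β} → α ∧ᶠ β ⊢ α
  π₁ = ∧L₁ _ _

  π₂ : ∀ {α β} → α ∧ᶠ β ⊢ β
  π₂ = ∧L₂ _ _

  ∧-map : ∀ {α β α′ β′} → α ⊢ α′ → β ⊢ β′ → α ∧ᶠ β ⊢ α′ ∧ᶠ β′
  ∧-map p q = ∧R (π₁ ∙ p) (π₂ ∙ q)

  ∨-map : ∀ {α β α′ β′} → α ⊢ α′ → β ⊢ β′ → α ∨ᶠ β ⊢ α′ ∨ᶠ β′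
  ∨-map p q = ∨L (p ∙ ∨R₁ _ _) (q ∙ ∨R₂ _ _)

  ⋀-elim : ∀ L {α} → α ∈ L → ⋀ L ⊢ α
  ⋀-elim (α ∷ [])    (here refl) = A α
  ⋀-elim (α ∷ β ∷ L) (here refl) = π₁
  ⋀-elim (α ∷ β ∷ L) (there α∈)  = π₂ ∙ ⋀-elim (β ∷ L) α∈

  ⋀-intro : ∀ L {χ} → (∀ {α} → α ∈ L → χ ⊢ α) → χ ⊢ ⋀ L
  ⋀-intro []          h = ⊢⊤ _
  ⋀-intro (α ∷ [])    h = h (here refl)
  ⋀-intro (α ∷ β ∷ L) h = ∧R (h (here refl)) (⋀-intro (β ∷ L) (h ∘ there))

  ⋀-mono : ∀ L M → M ⊆ L → ⋀ L ⊢ ⋀ M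
  ⋀-mono L M M⊆L = ⋀-intro M (⋀-elim L ∘ M⊆L)

  ⋁ᵃ-intro : ∀ α L {β} → β ∈ α ∷ L → β ⊢ ⋁ᵃ α L
  ⋁ᵃ-intro α []      (here refl) = A α
  ⋁ᵃ-intro α (β ∷ L) (here refl) = ∨R₁ _ _
  ⋁ᵃ-intro α (β ∷ L) (there β∈)  = ⋁ᵃ-intro β L β∈ ∙ ∨R₂ _ _

  ⋁ᵃ-elim : ∀ α L {χ} → (∀ {β} → β ∈ α ∷ L → β ⊢ χ) → ⋁ᵃ α L ⊢ χ
  ⋁ᵃ-elim α []      h = h (here refl)
  ⋁ᵃ-elim α (β ∷ L) h = ∨L (h (here refl)) (⋁ᵃ-elim β L (h ∘ there))

  ⋁-intro : ∀ (L : List⁺ Form) {α} → α ∈ toList L → α ⊢ ⋁⁺ L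
  ⋁-intro (α ∷ L) = ⋁ᵃ-intro α L

  ⋁-elim : ∀ (L : List⁺ Form) {χ} → (∀ {α} → α ∈ toList L → α ⊢ χ) → ⋁⁺ L ⊢ χ
  ⋁-elim (α ∷ L) = ⋁ᵃ-elim α L

  ⋁-mono : ∀ L M → toList L ⊆ toList M → ⋁⁺ L ⊢ ⋁⁺ M
  ⋁-mono L M L⊆M = ⋁-elim L (⋁-intro M ∘ L⊆M)

Pairs : Set
Pairs = List⁺ (Form × Form)

⋁impl : Pairs → Form
⋁impl ps = ⋁⁺ (L⁺.map impl ps)

⋀ante : Form → Pairs → Form
⋀ante c ps = ⋀⁺ (L⁺.map (c ∧ᶠ_) (L⁺.map proj₁ ps))

⋀succ⇒ : Form → Pairs → Form → Form
⋀succ⇒ c ps χ = ⋀⁺ (L⁺.map (λ ψ → c ∧ᶠ ψ ⇒ χ) (L⁺.map proj₂ ps))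

subst-⊢ : ∀ {k α α′ β β′} → α ≡ α′ → β ≡ β′ → α ⊢[ k ] β → α′ ⊢[ k ] β′
subst-⊢ {k} = subst₂ (_⊢[ k ]_)

-- The n-ary rules are only ever needed with all ψ_j equal to one context formula c.
uniform : Form → Form × Form → Tri
uniform c (φ , ψ) = φ , ψ , c

module _ (c : Form) (ps : Pairs) where

  ⋁impl-uniform : ⋁⁺ (L⁺.map (λ t → tα t ⇒ tβ t) (L⁺.map (uniform c) ps)) ≡ ⋁impl ps
  ⋁impl-uniform = cong ⋁⁺ (sym (L⁺.map-∘ ps))

  ⋀ante-uniform : ⋀⁺ (L⁺.map (λ t → tψ t ∧ᶠ tα t) (L⁺.map (uniform c) ps)) ≡ ⋀ante c ps
  ⋀ante-uniform = cong ⋀⁺ (map-factor (λ _ → refl) ps)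

  ⋀succ⇒-uniform : ∀ χ → ⋀⁺ (L⁺.map (λ t → tψ t ∧ᶠ tβ t ⇒ χ) (L⁺.map (uniform c) ps)) ≡ ⋀succ⇒ c ps χ
  ⋀succ⇒-uniform χ = cong ⋀⁺ (map-factor (λ _ → refl) ps)

  ⇒∨s-uniform : ∀ {k} χ → ⋁impl ps ∧ᶠ ⋀succ⇒ c ps χ ⊢[ k ] ⋀ante c ps ⇒ χ
  ⇒∨s-uniform χ = subst-⊢ (cong₂ _∧ᶠ_ ⋁impl-uniform (⋀succ⇒-uniform χ)) (cong (_⇒ χ) ⋀ante-uniform)
                          (⇒∨s (L⁺.map (uniform c) ps) χ)

  Refl₁-uniform : ∀ χ → (∀ {ψ} → ψ ∈ toList (L⁺.map proj₂ ps) → c ∧ᶠ ψ ⊢[ k₂ ] χ) →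
                  ⋀ante c ps ∧ᶠ ⋁impl ps ⊢[ k₂ ] χ
  Refl₁-uniform χ h = subst-⊢ (cong₂ _∧ᶠ_ ⋀ante-uniform ⋁impl-uniform) refl
                              (Refl₁ (L⁺.map (uniform c) ps) χ premise)
    where
      premise : ∀ t → t ∈ toList (L⁺.map (uniform c) ps) → tψ t ∧ᶠ tβ t ⊢[ k₂ ] χ
      premise t t∈ with ∈-map⁻ (uniform c) t∈
      ... | p , p∈ , refl = h (∈-map⁺ proj₂ p∈)

  Refl₂-uniform : ∀ χ → ⋀succ⇒ c ps χ ⊢[ k₂ ] (⋀ante c ps ∧ᶠ ⋁impl ps) ⇒ χ
  Refl₂-uniform χ = subst-⊢ (⋀succ⇒-uniform χ) (cong (_⇒ χ) (cong₂ _∧ᶠ_ ⋀ante-uniform ⋁impl-uniform))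
                            (Refl₂ (L⁺.map (uniform c) ps) χ)

compounds : List Form → List Form
compounds Fs =
  cartesianProductWith _∧ᶠ_ Fs Fs ++ cartesianProductWith _∨ᶠ_ Fs Fs ++ cartesianProductWith _⇒_ Fs Fs

enum : ℕ → List Form
enum zero    = []
enum (suc n) = fvar n ∷ fbot ∷ enum n ++ compounds (enum n)

enum-mono : ∀ {m n} → m ≤ n → enum m ⊆ enum n
enum-mono m≤n = go (≤⇒≤′ m≤n)
  where
    go : ∀ {m n} → m ≤′ n → enum m ⊆ enum n
    go ≤′-refl       = id
    go (≤′-step m≤n) = there ∘ there ∘ ∈-++⁺ˡ ∘ go m≤n

enum-compound : ∀ {α β φ} → (∀ Fs → α ∈ Fs → β ∈ Fs → φ ∈ compounds Fs) →
                ∃ (λ n → α ∈ enum n) → ∃ (λ n → β ∈ enum n) → ∃ λ n → φ ∈ enum n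
enum-compound φ∈ (m , α∈) (n , β∈) =
  suc (m ⊔ n) ,
  there (there (∈-++⁺ʳ (enum (m ⊔ n)) (φ∈ _ (enum-mono (m≤m⊔n m n) α∈) (enum-mono (m≤n⊔m m n) β∈))))

enum-complete : ∀ φ → ∃ λ n → φ ∈ enum n
enum-complete (fvar p) = suc p , here refl
enum-complete fbot     = 1 , there (here refl)
enum-complete (α ∧ᶠ β) = enum-compound (λ Fs α∈ β∈ → ∈-++⁺ˡ (∈-cartesianProductWith⁺ _∧ᶠ_ α∈ β∈))
                                       (enum-complete α) (enum-complete β)
enum-complete (α ∨ᶠ β) = enum-compound (λ Fs α∈ β∈ → ∈-++⁺ʳ (cartesianProductWith _∧ᶠ_ Fs Fs)
                                         (∈-++⁺ˡ (∈-cartesianProductWith⁺ _∨ᶠ_ α∈ β∈)))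
                                       (enum-complete α) (enum-complete β)
enum-complete (α ⇒ β)  = enum-compound (λ Fs α∈ β∈ → ∈-++⁺ʳ (cartesianProductWith _∧ᶠ_ Fs Fs)
                                         (∈-++⁺ʳ (cartesianProductWith _∨ᶠ_ Fs Fs)
                                           (∈-cartesianProductWith⁺ _⇒_ α∈ β∈)))
                                       (enum-complete α) (enum-complete β)

module _ {Ax : IForm → Set} where

  Der-hyp-mono : ∀ {H H′ : IForm → Set} → (∀ {ι} → H ι → H′ ι) → ∀ {ι} → Der Ax H ι → Der Ax H′ ι
  Der-hyp-mono f (hyp h)                     = hyp (f h)
  Der-hyp-mono f (ax a)                      = ax a
  Der-hyp-mono f (resp e d)                  = resp e (Der-hyp-mono f d)
  Der-hyp-mono f (i-A Δ Θ x)                 = i-A Δ Θ x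
  Der-hyp-mono f (i-Cut Δ₁ Θ₁ Δ₂ Θ₂ φ d₁ d₂) = i-Cut Δ₁ Θ₁ Δ₂ Θ₂ φ (Der-hyp-mono f d₁) (Der-hyp-mono f d₂)
  Der-hyp-mono f (i-∧L₁ φ ψ)                 = i-∧L₁ φ ψ
  Der-hyp-mono f (i-∧L₂ φ ψ)                 = i-∧L₂ φ ψ
  Der-hyp-mono f (i-∧R φ ψ)                  = i-∧R φ ψ

module _ {Ax H : IForm → Set} where

  Der-resp : ∀ {Δ Θ Δ′ Θ′} → toList Δ ⊆ toList Δ′ → toList Δ′ ⊆ toList Δ →
             toList Θ ⊆ toList Θ′ → toList Θ′ ⊆ toList Θ → Der Ax H (Δ ⊐ Θ) → Der Ax H (Δ′ ⊐ Θ′)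
  Der-resp Δ⊆ Δ⊇ Θ⊆ Θ⊇ = resp ((λ _ → mk⇔ Δ⊆ Δ⊇) , (λ _ → mk⇔ Θ⊆ Θ⊇))

  Der-weaken : ∀ {Δ′ Θ′ Δ Θ} → toList Δ′ ⊆ toList Δ → toList Θ′ ⊆ toList Θ →
               Der Ax H (Δ′ ⊐ Θ′) → Der Ax H (Δ ⊐ Θ)
  Der-weaken {Δ′} {θ ∷ θs} {Δ} {Θ} Δ′⊆ Θ′⊆ d =
    Der-resp (++-⊆ Δ′⊆ id) (xs⊆ys++xs _ (toList Δ′)) (++⁺-⊆ (Θ′⊆ ∘ there) id) (⊆-++⁺ʳ θs Θ)
      (i-Cut Δ′ θs (toList Δ) Θ θ d (i-A (θ ∷ toList Δ) Θ (θ , here refl , Θ′⊆ (here refl))))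

  Der-cut-self : ∀ {Δ Θ φ} → Der Ax H (Δ ⊐ (φ ∷ toList Θ)) → Der Ax H ((φ ∷ toList Δ) ⊐ Θ) →
                 Der Ax H (Δ ⊐ Θ)
  Der-cut-self {Δ} {Θ} {φ} d₁ d₂ =
    Der-resp (++-⊆ id id) (xs⊆ys++xs _ (toList Δ)) (++⁺-⊆ id id) (⊆-++⁺ʳ (toList Θ) Θ)
      (i-Cut Δ (toList Θ) (toList Δ) Θ φ d₁ d₂)

AxK : K → Form → IForm → Set
AxK k₁ γ = NoAx
AxK k₂ γ = γRefl γ

PropK : ∀ k α γ → Der (AxK k γ) (iγ γ (α ⊢[ k ]_)) ⊤⊐⊥ → α ⊢[ k ] γ
PropK k₁ = Prop₁
PropK k₂ = Prop₂

Holds : (Form → Set) → IForm → Set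
Holds P (Δ ⊐ Θ) = (∀ {α} → α ∈ toList Δ → P α) → ∃ λ β → β ∈ toList Θ × P β

Refutes : (Form → Set) → IForm → Set
Refutes P (Δ ⊐ Θ) = (∀ {α} → α ∈ toList Δ → P α) × (∀ {β} → β ∈ toList Θ → ¬ P β)

holds-sequent : ∀ {P α β} → Holds P ([ α ] ⊐ [ β ]) → P α → P β
holds-sequent holds Pα with holds (λ { (here refl) → Pα })
... | _ , here refl , Pβ = Pβ

holds-∧ : ∀ {P α β} → Holds P ((α ∷ β ∷ []) ⊐ [ α ∧ᶠ β ]) → P α → P β → P (α ∧ᶠ β)
holds-∧ holds Pα Pβ with holds (λ { (here refl) → Pα ; (there (here refl)) → Pβ })
... | _ , here refl , Pαβ = Pαβ

holds-¬refutes : ∀ {P} ι → Holds P ι → ¬ Refutes P ι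
holds-¬refutes ι holds (Δ⊆P , Θ∩P=∅) with holds Δ⊆P
... | β , β∈ , Pβ = Θ∩P=∅ β∈ Pβ

pairs-iformula : Pairs → IForm
pairs-iformula ps = L⁺.map proj₁ ps ⊐ L⁺.map proj₂ ps

refutes-++ : ∀ {P} ps₁ ps₂ → Refutes P (pairs-iformula ps₁) → Refutes P (pairs-iformula ps₂) →
             Refutes P (pairs-iformula (ps₁ ⁺++⁺ ps₂))
refutes-++ {P} ps₁ ps₂ (Δ₁⊆P , Θ₁∩P=∅) (Δ₂⊆P , Θ₂∩P=∅) =
  map-∀ P proj₁ ps₁₂ (λ p∈ → [ Δ₁⊆P ∘ ∈-map⁺ proj₁ , Δ₂⊆P ∘ ∈-map⁺ proj₁ ]′ (∈-++⁻ (toList ps₁) p∈)) ,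
  map-∀ (¬_ ∘ P) proj₂ ps₁₂ (λ p∈ → [ Θ₁∩P=∅ ∘ ∈-map⁺ proj₂ , Θ₂∩P=∅ ∘ ∈-map⁺ proj₂ ]′ (∈-++⁻ (toList ps₁) p∈))
  where
    ps₁₂ : List (Form × Form)
    ps₁₂ = toList ps₁ ++ toList ps₂

module Lindenbaum (em : ExcludedMiddle 0ℓ) {Ax H : IForm → Set}
                  (Δ₀ Θ₀ : List⁺ Form) (Δ₀⊬Θ₀ : ¬ Der Ax H (Δ₀ ⊐ Θ₀)) where

  Stage : Set
  Stage = List⁺ Form × List⁺ Form

  Underivable : Stage → Set
  Underivable (Δ , Θ) = ¬ Der Ax H (Δ ⊐ Θ)

  _⊑_ : Stage → Stage → Set
  (Δ , Θ) ⊑ (Δ′ , Θ′) = toList Δ ⊆ toList Δ′ × toList Θ ⊆ toList Θ′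

  ⊑-refl : ∀ {s} → s ⊑ s
  ⊑-refl = id , id

  ⊑-trans : ∀ {s t u} → s ⊑ t → t ⊑ u → s ⊑ u
  ⊑-trans (Δ⊆ , Θ⊆) (Δ⊆′ , Θ⊆′) = Δ⊆′ ∘ Δ⊆ , Θ⊆′ ∘ Θ⊆

  Decides : Stage → Form → Set
  Decides (Δ , Θ) φ = φ ∈ toList Δ ⊎ φ ∈ toList Θ

  decides-mono : ∀ {s t φ} → s ⊑ t → Decides s φ → Decides t φ
  decides-mono (Δ⊆ , Θ⊆) = [ inj₁ ∘ Δ⊆ , inj₂ ∘ Θ⊆ ]′

  add : Stage → Form → Stage
  add (Δ , Θ) φ with em {Der Ax H ((φ ∷⁺ Δ) ⊐ Θ)}
  ... | yes _ = Δ , φ ∷⁺ Θ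
  ... | no _  = φ ∷⁺ Δ , Θ

  add-underivable : ∀ s φ → Underivable s → Underivable (add s φ)
  add-underivable (Δ , Θ) φ Δ⊬Θ with em {Der Ax H ((φ ∷⁺ Δ) ⊐ Θ)}
  ... | yes φΔ⊢Θ = λ Δ⊢φΘ → Δ⊬Θ (Der-cut-self Δ⊢φΘ φΔ⊢Θ)
  ... | no φΔ⊬Θ  = φΔ⊬Θ

  add-⊒ : ∀ s φ → s ⊑ add s φ
  add-⊒ (Δ , Θ) φ with em {Der Ax H ((φ ∷⁺ Δ) ⊐ Θ)}
  ... | yes _ = id , there
  ... | no _  = there , id

  add-decides : ∀ s φ → Decides (add s φ) φ
  add-decides (Δ , Θ) φ with em {Der Ax H ((φ ∷⁺ Δ) ⊐ Θ)}
  ... | yes _ = inj₂ (here refl)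
  ... | no _  = inj₁ (here refl)

  addAll : Stage → List Form → Stage
  addAll s []       = s
  addAll s (φ ∷ Fs) = addAll (add s φ) Fs

  addAll-underivable : ∀ s Fs → Underivable s → Underivable (addAll s Fs)
  addAll-underivable s []       u = u
  addAll-underivable s (φ ∷ Fs) u = addAll-underivable (add s φ) Fs (add-underivable s φ u)

  addAll-⊒ : ∀ s Fs → s ⊑ addAll s Fs
  addAll-⊒ s []       = ⊑-refl
  addAll-⊒ s (φ ∷ Fs) = ⊑-trans (add-⊒ s φ) (addAll-⊒ (add s φ) Fs)

  addAll-decides : ∀ s Fs {φ} → φ ∈ Fs → Decides (addAll s Fs) φ
  addAll-decides s (φ ∷ Fs) (here refl) = decides-mono (addAll-⊒ (add s φ) Fs) (add-decides s φ)
  addAll-decides s (ψ ∷ Fs) (there φ∈)  = addAll-decides (add s ψ) Fs φ∈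

  stage : ℕ → Stage
  stage zero    = Δ₀ , Θ₀
  stage (suc n) = addAll (stage n) (enum n)

  stage-underivable : ∀ n → Underivable (stage n)
  stage-underivable zero    = Δ₀⊬Θ₀
  stage-underivable (suc n) = addAll-underivable (stage n) (enum n) (stage-underivable n)

  stage-mono : ∀ {m n} → m ≤ n → stage m ⊑ stage n
  stage-mono m≤n = go (≤⇒≤′ m≤n)
    where
      go : ∀ {m n} → m ≤′ n → stage m ⊑ stage n
      go ≤′-refl               = ⊑-refl
      go (≤′-step {n} m≤n) = ⊑-trans (go m≤n) (addAll-⊒ (stage n) (enum n))

  stage-decides : ∀ φ → ∃ λ n → Decides (stage n) φ
  stage-decides φ with enum-complete φ
  ... | n , φ∈ = suc n , addAll-decides (stage n) (enum n) φ∈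

  InAnte InSucc : ℕ → Form → Set
  InAnte n φ = φ ∈ toList (proj₁ (stage n))
  InSucc n φ = φ ∈ toList (proj₂ (stage n))

  Member : Form → Set
  Member φ = ∃ λ n → InAnte n φ

  nonmember-succ : ∀ {φ} → ¬ Member φ → ∃ λ n → InSucc n φ
  nonmember-succ {φ} φ∉ with stage-decides φ
  ... | n , inj₁ φ∈Δ = ⊥-elim (φ∉ (n , φ∈Δ))
  ... | n , inj₂ φ∈Θ = n , φ∈Θ

  ante-member : ∀ {φ} → φ ∈ toList Δ₀ → Member φ
  ante-member φ∈ = 0 , φ∈

  succ-nonmember : ∀ {φ} → φ ∈ toList Θ₀ → ¬ Member φ
  succ-nonmember {φ} φ∈Θ₀ (n , φ∈Δ) =
    stage-underivable n (i-A _ _ (φ , φ∈Δ , proj₂ (stage-mono {0} {n} z≤n) φ∈Θ₀))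

  member-holds : ∀ ι → Der Ax H ι → Holds Member ι
  member-holds (Δ ⊐ Θ) Δ⊢Θ Δ⊆M with em {∃ λ β → β ∈ toList Θ × Member β}
  ... | yes Θ∩M = Θ∩M
  ... | no Θ∩M=∅
    with eventually-all InAnte (λ m≤n → proj₁ (stage-mono m≤n)) (toList Δ) Δ⊆M
       | eventually-all InSucc (λ m≤n → proj₂ (stage-mono m≤n)) (toList Θ)
                        (λ β∈ → nonmember-succ (λ Mβ → Θ∩M=∅ (_ , β∈ , Mβ)))
  ... | m , Δ⊆stage | n , Θ⊆stage =
    ⊥-elim (stage-underivable (m ⊔ n)
      (Der-weaken (proj₁ (stage-mono (m≤m⊔n m n)) ∘ Δ⊆stage) (proj₂ (stage-mono (m≤n⊔m m n)) ∘ Θ⊆stage) Δ⊢Θ))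

Downward : K → (Form → Set) → Set
Downward k J = ∀ {α β} → α ⊢[ k ] β → J β → J α

Sequent : K → IForm → Set
Sequent k ι = ∃₂ λ α β → α ⊢[ k ] β × ι ≡ ([ α ] ⊐ [ β ])

Asserts : (Form → Set) → IForm → Set
Asserts T ι = ∃ λ t → T t × ι ≡ ([ ⊤ᶠ ] ⊐ [ t ])

Denies : (Form → Set) → IForm → Set
Denies J ι = ∃ λ j → J j × ι ≡ ([ j ] ⊐ [ fbot ])

record IsFilter (T : Form → Set) : Set where
  field
    ⊤-mem    : T ⊤ᶠ
    ∧-closed : ∀ {α β} → T α → T β → T (α ∧ᶠ β)

record IsTheory (k : K) (P : Form → Set) : Set where
  field
    isFilter : IsFilter P
    closed   : ∀ {α β} → α ⊢[ k ] β → P α → P β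
    ⊥-nonmem : ¬ P fbot

  open IsFilter isFilter public
  open Derived k

  ⇒-intro : ∀ {α β} → α ⊢ β → P (α ⇒ β)
  ⇒-intro α⊢β = closed (DT₀ α⊢β ⊤ᶠ) ⊤-mem

  ⇒-downward : ∀ χ → Downward k (λ ρ → P (ρ ⇒ χ))
  ⇒-downward χ {α} {β} α⊢β β⇒χ = closed (⇒tr α β χ) (∧-closed (⇒-intro α⊢β) β⇒χ)

  ⋀-closed : ∀ L → (∀ {α} → α ∈ L → P α) → P (⋀ L)
  ⋀-closed []          h = ⊤-mem
  ⋀-closed (α ∷ [])    h = h (here refl)
  ⋀-closed (α ∷ β ∷ L) h = ∧-closed (h (here refl)) (⋀-closed (β ∷ L) (h ∘ there))

  iγ-sequent : ∀ {γ ι} → Sequent k ι → iγ γ P ι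
  iγ-sequent (α , β , α⊢β , refl) = [ (α , β) ] , closed (DT₀ α⊢β ⊤ᶠ ∙ ∨R₁ _ _) ⊤-mem , refl

provable-filter : ∀ {k} χ → IsFilter (χ ⊢[ k ]_)
provable-filter χ = record { ⊤-mem = DT₀ (A fbot) χ ; ∧-closed = ∧R }

entailed-filter : ∀ {k} Γ → IsFilter (Γ ⊢ˢ[ k ]_)
entailed-filter {k} Γ = record
  { ⊤-mem    = [] , All.[] , A ⊤ᶠ
  ; ∧-closed = λ { (Γ₁ , Γ₁⊆Γ , ⋀Γ₁⊢α) (Γ₂ , Γ₂⊆Γ , ⋀Γ₂⊢β) →
      Γ₁ ++ Γ₂ , All.++⁺ Γ₁⊆Γ Γ₂⊆Γ ,
      ∧R (⋀-mono (Γ₁ ++ Γ₂) Γ₁ (xs⊆xs++ys Γ₁ Γ₂) ∙ ⋀Γ₁⊢α) (⋀-mono (Γ₁ ++ Γ₂) Γ₂ (xs⊆ys++xs Γ₂ Γ₁) ∙ ⋀Γ₂⊢β) }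
  }
  where open Derived k

module _ {P Q : Form → Set} (P⇔Q : ∀ {φ} → P φ ⇔ Q φ) where
  open Equivalence

  holds-resp : ∀ {ι} → Holds P ι → Holds Q ι
  holds-resp holds Δ⊆Q with holds (from P⇔Q ∘ Δ⊆Q)
  ... | β , β∈ , Pβ = β , β∈ , to P⇔Q Pβ

  theory-resp : ∀ {k} → IsTheory k P → IsTheory k Q
  theory-resp P-theory = record
    { isFilter = record
      { ⊤-mem    = to P⇔Q ⊤-mem
      ; ∧-closed = λ Qα Qβ → to P⇔Q (∧-closed (from P⇔Q Qα) (from P⇔Q Qβ))
      }
    ; closed   = λ α⊢β → to P⇔Q ∘ closed α⊢β ∘ from P⇔Q
    ; ⊥-nonmem = ⊥-nonmem ∘ from P⇔Q
    }
    where open IsTheory P-theory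

-- Derivations preserve validity, so a suitable J and T witness that an i-formula is underivable.
Valid : (J T : Form → Set) → IForm → Set
Valid J T (Δ ⊐ Θ) =
  ∀ c → (∀ {β} → β ∈ toList Θ → J (c ∧ᶠ β)) → ∃ λ t → T t × J (c ∧ᶠ (t ∧ᶠ ⋀⁺ Δ))

module Validity {k : K} {J : Form → Set} (J-down : Downward k J) {T : Form → Set} (T-filter : IsFilter T) where
  open Derived k
  open IsFilter T-filter

  valid-entailment : ∀ Δ Θ {β} → ⋀⁺ Δ ⊢ β → β ∈ toList Θ → Valid J T (Δ ⊐ Θ)
  valid-entailment Δ Θ Δ⊢β β∈ c J-Θ = ⊤ᶠ , ⊤-mem , J-down (∧-map (A c) (π₂ ∙ Δ⊢β)) (J-Θ β∈)

  valid-resp : ∀ {ι ι′} → ι ≈ᵢ ι′ → Valid J T ι → Valid J T ι′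
  valid-resp {Δ ⊐ _} {Δ′ ⊐ _} (Δ≋ , Θ≋) v c J-Θ′ with v c (J-Θ′ ∘ Equivalence.to (Θ≋ _))
  ... | t , Tt , J-Δ = t , Tt , J-down (∧-map (A c) (∧-map (A t) Δ′⊢Δ)) J-Δ
    where
      Δ′⊢Δ : ⋀⁺ Δ′ ⊢ ⋀⁺ Δ
      Δ′⊢Δ = ⋀-mono (toList Δ′) (toList Δ) (Equivalence.to (Δ≋ _))

  cut-formula-refuted : ∀ {c t φ Δ Θ} → (∀ {β} → β ∈ Θ → J (c ∧ᶠ β)) → J (c ∧ᶠ (t ∧ᶠ ⋀ (φ ∷ Δ))) →
                        ∀ {β} → β ∈ φ ∷ Θ → J ((c ∧ᶠ (t ∧ᶠ ⋀ Δ)) ∧ᶠ β)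
  cut-formula-refuted {φ = φ} {Δ} J-Θ J-φΔ (here refl) =
    J-down (∧R (π₁ ∙ π₁) (∧R (π₁ ∙ π₂ ∙ π₁) (⋀-intro (φ ∷ Δ) λ { (here refl) → π₂
                                                              ; (there α∈) → π₁ ∙ π₂ ∙ π₂ ∙ ⋀-elim Δ α∈ })))
           J-φΔ
  cut-formula-refuted J-Θ J-φΔ (there β∈) = J-down (∧-map π₁ (A _)) (J-Θ β∈)

  valid-cut : ∀ Δ₁ Θ₁ Δ₂ Θ₂ φ → Valid J T (Δ₁ ⊐ (φ ∷ Θ₁)) → Valid J T ((φ ∷ Δ₂) ⊐ Θ₂) →
              Valid J T ((Δ₁ ⁺++ Δ₂) ⊐ (Θ₁ ++⁺ Θ₂))
  valid-cut Δ₁ Θ₁ Δ₂ Θ₂ φ v₁ v₂ c J-Θ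
    with v₂ c (J-Θ ∘ ⊆-++⁺ʳ Θ₁ Θ₂)
  ... | t₂ , T-t₂ , J₂
    with v₁ (c ∧ᶠ (t₂ ∧ᶠ ⋀ Δ₂)) (cut-formula-refuted {Δ = Δ₂} (J-Θ ∘ ⊆-++⁺ˡ Θ₁ Θ₂) J₂)
  ... | t₁ , T-t₁ , J₁ = t₁ ∧ᶠ t₂ , ∧-closed T-t₁ T-t₂ , J-down regroup J₁
    where
      Δ₁₂ : List Form
      Δ₁₂ = toList Δ₁ ++ Δ₂
      regroup : c ∧ᶠ ((t₁ ∧ᶠ t₂) ∧ᶠ ⋀ Δ₁₂) ⊢ (c ∧ᶠ (t₂ ∧ᶠ ⋀ Δ₂)) ∧ᶠ (t₁ ∧ᶠ ⋀⁺ Δ₁)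
      regroup = ∧R (∧R π₁ (∧R (π₂ ∙ π₁ ∙ π₂) (π₂ ∙ π₂ ∙ ⋀-mono Δ₁₂ Δ₂ (xs⊆ys++xs Δ₂ (toList Δ₁)))))
                   (∧R (π₂ ∙ π₁ ∙ π₁) (π₂ ∙ π₂ ∙ ⋀-mono Δ₁₂ (toList Δ₁) (xs⊆xs++ys (toList Δ₁) Δ₂)))

  valid : ∀ {Ax H} → (∀ {ι} → H ι → Valid J T ι) → (∀ {ι} → Ax ι → Valid J T ι) →
          ∀ {ι} → Der Ax H ι → Valid J T ι
  valid v-H v-Ax (hyp h)                   = v-H h
  valid v-H v-Ax (ax a)                    = v-Ax a
  valid v-H v-Ax (resp ι≈ d)               = valid-resp ι≈ (valid v-H v-Ax d)
  valid v-H v-Ax (i-A Δ Θ (α , α∈Δ , α∈Θ)) = valid-entailment Δ Θ (⋀-elim (toList Δ) α∈Δ) α∈Θ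
  valid v-H v-Ax (i-Cut Δ₁ Θ₁ Δ₂ Θ₂ φ d₁ d₂) =
    valid-cut Δ₁ Θ₁ Δ₂ Θ₂ φ (valid v-H v-Ax d₁) (valid v-H v-Ax d₂)
  valid v-H v-Ax (i-∧L₁ φ ψ)               = valid-entailment [ φ ∧ᶠ ψ ] [ φ ] π₁ (here refl)
  valid v-H v-Ax (i-∧L₂ φ ψ)               = valid-entailment [ φ ∧ᶠ ψ ] [ ψ ] π₂ (here refl)
  valid v-H v-Ax (i-∧R φ ψ)                = valid-entailment (φ ∷ ψ ∷ []) [ φ ∧ᶠ ψ ] (A _) (here refl)

  valid-sequent : ∀ {ι} → Sequent k ι → Valid J T ι
  valid-sequent (α , β , α⊢β , refl) = valid-entailment [ α ] [ β ] α⊢β (here refl)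

  valid-asserts : ∀ {ι} → Asserts T ι → Valid J T ι
  valid-asserts (t , Tt , refl) c J-t = t , Tt , J-down (∧-map (A c) π₁) (J-t (here refl))

  valid-denies : ∀ {ι} → Denies J ι → Valid J T ι
  valid-denies (j , Jj , refl) c _ = ⊤ᶠ , ⊤-mem , J-down (π₂ ∙ π₂) Jj

  underivable : ∀ {Ax H Δ₀ Θ₀} → (∀ {ι} → H ι → Valid J T ι) → (∀ {ι} → Ax ι → Valid J T ι) →
                (∀ {β} → β ∈ toList Θ₀ → J (⊤ᶠ ∧ᶠ β)) → (∀ {t} → T t → ¬ J (⊤ᶠ ∧ᶠ (t ∧ᶠ ⋀⁺ Δ₀))) →
                ¬ Der Ax H (Δ₀ ⊐ Θ₀)
  underivable v-H v-Ax J-Θ₀ ¬J d with valid v-H v-Ax d ⊤ᶠ J-Θ₀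
  ... | t , Tt , J-Δ₀ = ¬J Tt J-Δ₀

module _ {k : K} where
  open Derived k

  ⋀ante-intro : ∀ c t L ps → toList (L⁺.map proj₁ ps) ⊆ L → c ∧ᶠ (t ∧ᶠ ⋀ L) ⊢ ⋀ante c ps
  ⋀ante-intro c t L ps ⊆L =
    ⋀-intro _ (map-∀ (c ∧ᶠ (t ∧ᶠ ⋀ L) ⊢_) (c ∧ᶠ_) (toList (L⁺.map proj₁ ps))
                     λ φ∈ → ∧R π₁ (π₂ ∙ π₂ ∙ ⋀-elim L (⊆L φ∈)))

  γRefl⊥-premise : ∀ c t ps →
                   c ∧ᶠ (t ∧ᶠ ⋀ ((⋁impl ps ∨ᶠ fbot) ∷ toList (L⁺.map proj₁ ps))) ⊢ ⋀ante c ps ∧ᶠ ⋁impl ps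
  γRefl⊥-premise c t ps = ∧R (⋀ante-intro c t L ps there) (π₂ ∙ π₂ ∙ ⋀-elim L (here refl) ∙ ∨L (A _) (⊥L _))
    where
      L : List Form
      L = (⋁impl ps ∨ᶠ fbot) ∷ toList (L⁺.map proj₁ ps)

module _ {k : K} {P : Form → Set} (P-theory : IsTheory k P) (χ : Form)
         {T : Form → Set} (T-filter : IsFilter T) where
  open Derived k
  open IsTheory P-theory
  open IsFilter T-filter using () renaming (⊤-mem to T-⊤)

  ⋀succ⇒-mem : ∀ c ps → (∀ {ψ} → ψ ∈ toList (L⁺.map proj₂ ps) → P (c ∧ᶠ ψ ⇒ χ)) → P (⋀succ⇒ c ps χ)
  ⋀succ⇒-mem c ps h = ⋀-closed _ (map-∀ P (λ ψ → c ∧ᶠ ψ ⇒ χ) (toList (L⁺.map proj₂ ps)) h)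

  valid-iγ⊥ : ∀ {ι} → iγ fbot P ι → Valid (λ ρ → P (ρ ⇒ χ)) T ι
  valid-iγ⊥ (ps , ⋁ps∨⊥ , refl) c J-Θ =
    ⊤ᶠ , T-⊤ , ⇒-downward χ (⋀ante-intro c ⊤ᶠ _ ps id)
                 (closed (⇒∨s-uniform c ps χ) (∧-closed ⋁ps (⋀succ⇒-mem c ps J-Θ)))
    where
      ⋁ps : P (⋁impl ps)
      ⋁ps = closed (∨L (A _) (⊥L _)) ⋁ps∨⊥

valid-AxK⊥-⇒ : ∀ k {P} → IsTheory k P → ∀ χ {T} → IsFilter T →
               ∀ {ι} → AxK k fbot ι → Valid (λ ρ → P (ρ ⇒ χ)) T ι
valid-AxK⊥-⇒ k₂ P-theory χ T-filter (mk ps) c J-Θ =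
  ⊤ᶠ , IsFilter.⊤-mem T-filter ,
  ⇒-downward χ (γRefl⊥-premise c ⊤ᶠ ps)
    (closed (Refl₂-uniform c ps χ) (⋀succ⇒-mem P-theory χ T-filter c ps J-Θ))
  where open IsTheory P-theory

valid-AxK⊥-ideal : ∀ k {J} → Downward k J → (∀ {α β} → J α → J β → J (α ∨ᶠ β)) → ∀ {T} → IsFilter T →
                   ∀ {ι} → AxK k fbot ι → Valid J T ι
valid-AxK⊥-ideal k₂ {J} J-down J-∨ T-filter (mk ps) c J-Θ =
  ⊤ᶠ , IsFilter.⊤-mem T-filter ,
  J-down (γRefl⊥-premise c ⊤ᶠ ps ∙ Refl₁-uniform c ps χ (⋁-intro cψs ∘ ∈-map⁺ (c ∧ᶠ_))) (⋁-closed cψs J-cψs)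
  where
    open Derived k₂
    cψs : List⁺ Form
    cψs = L⁺.map (c ∧ᶠ_) (L⁺.map proj₂ ps)
    χ : Form
    χ = ⋁⁺ cψs
    J-cψs : ∀ {α} → α ∈ toList cψs → J α
    J-cψs = map-∀ J (c ∧ᶠ_) (toList (L⁺.map proj₂ ps)) J-Θ
    ⋁ᵃ-closed : ∀ α L → (∀ {β} → β ∈ α ∷ L → J β) → J (⋁ᵃ α L)
    ⋁ᵃ-closed α []      h = h (here refl)
    ⋁ᵃ-closed α (β ∷ L) h = J-∨ (h (here refl)) (⋁ᵃ-closed β L (h ∘ there))
    ⋁-closed : ∀ (L : List⁺ Form) → (∀ {α} → α ∈ toList L → J α) → J (⋁⁺ L)
    ⋁-closed (α ∷ L) = ⋁ᵃ-closed α L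

module _ {k : K} {Ax : IForm → Set} {γ : Form} {P : Form → Set} (P-filter : IsFilter P) where
  open Derived k
  open IsFilter P-filter

  iγ-compact : ∀ {ι} → Der Ax (iγ γ P) ι → ∃ λ ξ → P ξ × Der Ax (iγ γ (ξ ⊢_)) ι
  iγ-compact (hyp (ps , Pξ , ι≡)) = _ , Pξ , hyp (ps , A _ , ι≡)
  iγ-compact (ax a)               = ⊤ᶠ , ⊤-mem , ax a
  iγ-compact (resp ι≈ d) with iγ-compact d
  ... | ξ , Pξ , d′ = ξ , Pξ , resp ι≈ d′
  iγ-compact (i-A Δ Θ x)          = ⊤ᶠ , ⊤-mem , i-A Δ Θ x
  iγ-compact (i-Cut Δ₁ Θ₁ Δ₂ Θ₂ φ d₁ d₂) with iγ-compact d₁ | iγ-compact d₂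
  ... | ξ₁ , Pξ₁ , d₁′ | ξ₂ , Pξ₂ , d₂′ =
    ξ₁ ∧ᶠ ξ₂ , ∧-closed Pξ₁ Pξ₂ ,
    i-Cut Δ₁ Θ₁ Δ₂ Θ₂ φ (Der-hyp-mono (iγ-antitone π₁) d₁′) (Der-hyp-mono (iγ-antitone π₂) d₂′)
    where
      iγ-antitone : ∀ {ξ ξ′ ι} → ξ′ ⊢ ξ → iγ γ (ξ ⊢_) ι → iγ γ (ξ′ ⊢_) ι
      iγ-antitone ξ′⊢ξ (ps , ξ⊢ , ι≡) = ps , (ξ′⊢ξ ∙ ξ⊢) , ι≡
  iγ-compact (i-∧L₁ φ ψ)          = ⊤ᶠ , ⊤-mem , i-∧L₁ φ ψ
  iγ-compact (i-∧L₂ φ ψ)          = ⊤ᶠ , ⊤-mem , i-∧L₂ φ ψ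
  iγ-compact (i-∧R φ ψ)           = ⊤ᶠ , ⊤-mem , i-∧R φ ψ

module Canonical (em : ExcludedMiddle 0ℓ) (k : K) where
  open Derived k

  -- Membership is Bool-valued so that World : Set; excluded middle decides every predicate.
  record World : Set where
    field
      members : Form → Bool
      γ       : Form
      theory  : IsTheory k (Bool.T ∘ members)
      axioms  : ∀ {ι} → AxK k γ ι → Holds (Bool.T ∘ members) ι
  open World public

  infix 4 _∋_
  _∋_ : World → Form → Set
  w ∋ φ = Bool.T (members w φ)

  R : World → World → Set
  R w v = ∀ {ι} → iγ (γ v) (w ∋_) ι → Holds (v ∋_) ι

  R-antitone : ∀ {w u v} → (∀ {φ} → w ∋ φ → u ∋ φ) → R u v → R w v
  R-antitone w⊆u uRv (ps , ∈w , ι≡) = uRv (ps , w⊆u ∈w , ι≡)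

  decide : (Form → Set) → Form → Bool
  decide P φ = isYes (em {P φ})

  decide⇔ : ∀ P {φ} → P φ ⇔ Bool.T (decide P φ)
  decide⇔ P {φ} = mk⇔ (fromWitness {a? = em {P φ}}) (toWitness {a? = em {P φ}})

  record Extension (γ₀ : Form) (H : IForm → Set) (α β : Form) : Set₁ where
    field
      Member        : Form → Set
      member-theory : IsTheory k Member
      member-holds  : ∀ {ι} → Der (AxK k γ₀) H ι → Holds Member ι
      α-member      : Member α
      β-nonmember   : ¬ Member β

    world : World
    world = record
      { members = decide Member
      ; γ       = γ₀
      ; theory  = theory-resp (decide⇔ Member) member-theory
      ; axioms  = holds-resp (decide⇔ Member) ∘ member-holds ∘ ax
      }

    world-holds : ∀ {ι} → Der (AxK k γ₀) H ι → Holds (world ∋_) ι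
    world-holds = holds-resp (decide⇔ Member) ∘ member-holds

    α∈world : world ∋ α
    α∈world = Equivalence.to (decide⇔ Member) α-member

    β∉world : ¬ world ∋ β
    β∉world = β-nonmember ∘ Equivalence.from (decide⇔ Member)

  extend : ∀ γ₀ {H} α β → ¬ Der (AxK k γ₀) H ([ α ] ⊐ [ β ]) →
           (∀ {ι} → Sequent k ι → Der (AxK k γ₀) H ι) → Extension γ₀ H α β
  extend γ₀ α β α⊬β sequent = record
    { Member        = Member
    ; member-theory = record
      { isFilter = record
        { ⊤-mem    = closed (⊢⊤ α) α-member
        ; ∧-closed = holds-∧ (member-holds _ (i-∧R _ _))
        }
      ; closed   = closed
      ; ⊥-nonmem = λ ⊥∈ → β-nonmember (closed (⊥L β) ⊥∈)
      }
    ; member-holds  = member-holds _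
    ; α-member      = α-member
    ; β-nonmember   = β-nonmember
    }
    where
      open Lindenbaum em [ α ] [ β ] α⊬β
      α-member : Member α
      α-member = ante-member (here refl)
      β-nonmember : ¬ Member β
      β-nonmember = succ-nonmember (here refl)
      closed : ∀ {φ ψ} → φ ⊢ ψ → Member φ → Member ψ
      closed φ⊢ψ = holds-sequent (member-holds _ (sequent (_ , _ , φ⊢ψ , refl)))

  successor-avoiding : ∀ w φ → ¬ w ∋ φ → Σ World λ v → R w v × (∀ u → R u v → ¬ u ∋ φ)
  successor-avoiding w φ φ∉w = world , world-holds ∘ hyp , no-predecessor
    where
      open IsTheory (theory w)
      ⊤⊬⊥ : ¬ Der (AxK k φ) (iγ φ (w ∋_)) ⊤⊐⊥
      ⊤⊬⊥ d with iγ-compact isFilter d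
      ... | ξ , ξ∈w , d′ = φ∉w (closed (PropK k ξ φ d′) ξ∈w)
      open Extension (extend φ ⊤ᶠ fbot ⊤⊬⊥ (hyp ∘ iγ-sequent))
      no-predecessor : ∀ u → R u world → ¬ u ∋ φ
      no-predecessor u uRv φ∈u
        with uRv ([ (⊤ᶠ , fbot) ] , IsTheory.closed (theory u) (∨R₂ _ _) φ∈u , refl)
                 (λ { (here refl) → α∈world })
      ... | _ , here refl , ⊥∈v = β∉world ⊥∈v

  successor-refuting : ∀ w α β → ¬ w ∋ (α ⇒ β) → Σ World λ v → R w v × v ∋ α × ¬ v ∋ β
  successor-refuting w α β α⇒β∉w = world , world-holds ∘ hyp , α∈world , β∉world
    where
      open IsTheory (theory w)
      open Validity (⇒-downward β) (provable-filter ⊤ᶠ)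
      α⊬β : ¬ Der (AxK k fbot) (iγ fbot (w ∋_)) ([ α ] ⊐ [ β ])
      α⊬β = underivable (valid-iγ⊥ (theory w) β (provable-filter ⊤ᶠ))
                        (valid-AxK⊥-⇒ k (theory w) β (provable-filter ⊤ᶠ))
                        (λ { (here refl) → ⇒-intro π₂ ; (there ()) })
                        (λ ⊤⊢t → α⇒β∉w ∘ ⇒-downward β (∧R (⊢⊤ α) (∧R (⊢⊤ α ∙ ⊤⊢t) (A α))))
      open Extension (extend fbot α β α⊬β (hyp ∘ iγ-sequent))

  successor-above : ∀ w u → (∀ {φ} → u ∋ φ → ¬ w ∋ ¬ᶠ φ) → Σ World λ v → R w v × (∀ {φ} → u ∋ φ → v ∋ φ)
  successor-above w u consistent = world , world-holds ∘ hyp ∘ inj₁ , u⊆v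
    where
      open IsTheory (theory w)
      H : IForm → Set
      H ι = iγ fbot (w ∋_) ι ⊎ Asserts (u ∋_) ι
      u-filter : IsFilter (u ∋_)
      u-filter = IsTheory.isFilter (theory u)
      open Validity (⇒-downward fbot) u-filter
      ⊤⊬⊥ : ¬ Der (AxK k fbot) H ⊤⊐⊥
      ⊤⊬⊥ = underivable [ valid-iγ⊥ (theory w) fbot u-filter , valid-asserts ]′
                        (valid-AxK⊥-⇒ k (theory w) fbot u-filter)
                        (λ { (here refl) → ⇒-intro π₂ ; (there ()) })
                        (λ φ∈u → consistent φ∈u ∘ ⇒-downward fbot (∧R (⊢⊤ _) (∧R (A _) (⊢⊤ _))))
      open Extension (extend fbot ⊤ᶠ fbot ⊤⊬⊥ (hyp ∘ inj₁ ∘ iγ-sequent))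
      u⊆v : ∀ {φ} → u ∋ φ → world ∋ φ
      u⊆v φ∈u = holds-sequent (world-holds (hyp (inj₂ (_ , φ∈u , refl)))) α∈world

  Excluded : World → Form → Set
  Excluded v ρ = ∃ λ ps → ρ ⊢ ⋁impl ps ∨ᶠ γ v × Refutes (v ∋_) (pairs-iformula ps)

  excluded-downward : ∀ v → Downward k (Excluded v)
  excluded-downward v ρ⊢σ (ps , σ⊢ , refutes) = ps , (ρ⊢σ ∙ σ⊢) , refutes

  excluded-∨ : ∀ v {ρ σ} → Excluded v ρ → Excluded v σ → Excluded v (ρ ∨ᶠ σ)
  excluded-∨ v (ps₁ , ρ⊢ , refutes₁) (ps₂ , σ⊢ , refutes₂) =
    ps₁ ⁺++⁺ ps₂ ,
    ∨L (ρ⊢ ∙ ∨-map (⋁-mono _ _ (map⁺ impl (xs⊆xs++ys (toList ps₁) (toList ps₂)))) (A _))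
       (σ⊢ ∙ ∨-map (⋁-mono _ _ (map⁺ impl (xs⊆ys++xs (toList ps₂) (toList ps₁)))) (A _)) ,
    refutes-++ ps₁ ps₂ refutes₁ refutes₂

  excluded-⊥ : ∀ v → Excluded v fbot
  excluded-⊥ v = [ (⊤ᶠ , fbot) ] , ⊥L _ ,
                 (λ { (here refl) → IsTheory.⊤-mem (theory v) ; (there ()) }) ,
                 (λ { (here refl) → IsTheory.⊥-nonmem (theory v) ; (there ()) })

  excluded-¬R : ∀ {u v ρ} → Excluded v ρ → u ∋ ρ → ¬ R u v
  excluded-¬R {u} (ps , ρ⊢ , refutes) ρ∈u uRv =
    holds-¬refutes (pairs-iformula ps) (uRv (ps , IsTheory.closed (theory u) ρ⊢ ρ∈u , refl)) refutes

  predecessor-containing : ∀ v α → ¬ Excluded v α → Σ World λ u → R u v × u ∋ α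
  predecessor-containing v α α-allowed = world , uRv , α∈world
    where
      H : IForm → Set
      H ι = Sequent k ι ⊎ Denies (Excluded v) ι
      open Validity (excluded-downward v) (provable-filter ⊤ᶠ)
      α⊬⊥ : ¬ Der (AxK k fbot) H ([ α ] ⊐ [ fbot ])
      α⊬⊥ = underivable [ valid-sequent , valid-denies ]′
                        (valid-AxK⊥-ideal k (excluded-downward v) (excluded-∨ v) (provable-filter ⊤ᶠ))
                        (λ { (here refl) → excluded-downward v π₂ (excluded-⊥ v) ; (there ()) })
                        (λ ⊤⊢t → α-allowed ∘ excluded-downward v (∧R (⊢⊤ α) (∧R (⊢⊤ α ∙ ⊤⊢t) (A α))))
      open Extension (extend fbot α fbot α⊬⊥ (hyp ∘ inj₁))
      uRv : R world v
      uRv (ps , ∈u , refl) Δ⊆v with em {∃ λ β → β ∈ toList (L⁺.map proj₂ ps) × v ∋ β}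
      ... | yes holds = holds
      ... | no Θ∩v=∅  = ⊥-elim (β∉world (holds-sequent (world-holds (hyp (inj₂ (_ , excluded , refl)))) ∈u))
        where
          excluded : Excluded v (⋁impl ps ∨ᶠ γ v)
          excluded = ps , A _ , Δ⊆v , λ β∈ β∈v → Θ∩v=∅ (_ , β∈ , β∈v)

  countermodel-world : ∀ Γ φ → ¬ Γ ⊢ˢ[ k ] φ → Σ World λ w → (∀ γ → Γ γ → w ∋ γ) × ¬ w ∋ φ
  countermodel-world Γ φ Γ⊬φ = world , Γ⊆w , β∉world
    where
      H : IForm → Set
      H ι = Sequent k ι ⊎ Asserts (Γ ⊢ˢ[ k ]_) ι
      open Validity {J = _⊢ φ} (λ ρ⊢σ σ⊢φ → ρ⊢σ ∙ σ⊢φ) (entailed-filter Γ)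
      ⊤⊬φ : ¬ Der (AxK k fbot) H ([ ⊤ᶠ ] ⊐ [ φ ])
      ⊤⊬φ = underivable [ valid-sequent , valid-asserts ]′
                        (valid-AxK⊥-ideal k (λ ρ⊢σ σ⊢φ → ρ⊢σ ∙ σ⊢φ) ∨L (entailed-filter Γ))
                        (λ { (here refl) → π₂ ; (there ()) })
                        (λ { (Γ₀ , Γ₀⊆Γ , Γ₀⊢t) ⊤∧t⊢φ →
                               Γ⊬φ (Γ₀ , Γ₀⊆Γ , (∧R (⊢⊤ _) (∧R Γ₀⊢t (⊢⊤ _)) ∙ ⊤∧t⊢φ)) })
      open Extension (extend fbot ⊤ᶠ φ ⊤⊬φ (hyp ∘ inj₁))
      Γ⊆w : ∀ γ → Γ γ → world ∋ γ
      Γ⊆w γ γ∈Γ =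
        holds-sequent (world-holds (hyp (inj₂ (γ , ((γ ∷ []) , γ∈Γ All.∷ All.[] , A γ) , refl)))) α∈world

  open FrameOps R
  open Equivalence

  dne : DoubleNegationElimination 0ℓ
  dne = em⇒dne em

  ∋⇔□◇⁻¹ : ∀ φ w → w ∋ φ ⇔ □ (◇⁻¹ (_∋ φ)) w
  ∋⇔□◇⁻¹ φ w = mk⇔ (λ φ∈w v wRv → w , φ∈w , wRv) λ h → dne λ φ∉w →
    let (v , wRv , no-predecessor) = successor-avoiding w φ φ∉w
        (u , φ∈u , uRv)            = h v wRv
    in no-predecessor u uRv φ∈u

  ⇒∈⇔ : ∀ α β w → w ∋ α ⇒ β ⇔ (∀ v → R w v → v ∋ α → v ∋ β)
  ⇒∈⇔ α β w = mk⇔ to′ λ h → dne λ α⇒β∉w →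
      let (v , wRv , α∈v , β∉v) = successor-refuting w α β α⇒β∉w in β∉v (h v wRv α∈v)
    where
      to′ : w ∋ α ⇒ β → ∀ v → R w v → v ∋ α → v ∋ β
      to′ α⇒β∈w v wRv α∈v
        with wRv ([ (α , β) ] , IsTheory.closed (theory w) (∨R₁ _ _) α⇒β∈w , refl)
                 (λ { (here refl) → α∈v ; (there ()) })
      ... | _ , here refl , β∈v = β∈v

  ∨-predecessor : ∀ {w v α β} → w ∋ α ∨ᶠ β → R w v → ∃ λ u → (u ∋ α ⊎ u ∋ β) × R u v
  ∨-predecessor {w} {v} {α} {β} α∨β∈w wRv with em {Excluded v α} | em {Excluded v β}
  ... | no α-allowed | _ = let (u , uRv , α∈u) = predecessor-containing v α α-allowed in u , inj₁ α∈u , uRv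
  ... | yes _ | no β-allowed = let (u , uRv , β∈u) = predecessor-containing v β β-allowed in u , inj₂ β∈u , uRv
  ... | yes α-excluded | yes β-excluded =
    ⊥-elim (excluded-¬R {u = w} {v = v} (excluded-∨ v α-excluded β-excluded) α∨β∈w wRv)

  model : Model
  model = record
    { W    = World
    ; R    = R
    ; V    = λ p w → w ∋ fvar p
    ; V-FP = λ p → ◇⁻¹ (_∋ fvar p) , ∋⇔□◇⁻¹ (fvar p)
    }

  truth : ∀ φ w → ‖ model ‖ φ w ⇔ w ∋ φ
  truth (fvar p) w = mk⇔ id id
  truth fbot     w = mk⇔ (λ □∅ → let (v , wRv , _) = successor-avoiding w fbot ⊥-nonmem in ⊥-elim (□∅ v wRv))
                         (⊥-elim ∘ ⊥-nonmem)
    where open IsTheory (theory w)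
  truth (α ∧ᶠ β) w = mk⇔ (λ (α∈ , β∈) → ∧-closed (to (truth α w) α∈) (to (truth β w) β∈))
                         (λ α∧β∈w → from (truth α w) (closed π₁ α∧β∈w) , from (truth β w) (closed π₂ α∧β∈w))
    where open IsTheory (theory w)
  truth (α ∨ᶠ β) w = mk⇔ to′ from′
    where
      to′ : ‖ model ‖ (α ∨ᶠ β) w → w ∋ α ∨ᶠ β
      to′ h = from (∋⇔□◇⁻¹ (α ∨ᶠ β) w) λ v wRv →
        let (u , α∪β , uRv) = h v wRv
        in u , [ IsTheory.closed (theory u) (∨R₁ α β) ∘ to (truth α u)
               , IsTheory.closed (theory u) (∨R₂ α β) ∘ to (truth β u) ]′ α∪β , uRv
      from′ : w ∋ α ∨ᶠ β → ‖ model ‖ (α ∨ᶠ β) w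
      from′ α∨β∈w v wRv =
        let (u , α∪β , uRv) = ∨-predecessor {w = w} {v = v} α∨β∈w wRv
        in u , [ inj₁ ∘ from (truth α u) , inj₂ ∘ from (truth β u) ]′ α∪β , uRv
  truth (α ⇒ β)  w = mk⇔ to′ from′
    where
      to′ : ‖ model ‖ (α ⇒ β) w → w ∋ α ⇒ β
      to′ h = from (⇒∈⇔ α β w) λ v wRv α∈v →
        [ (λ α∉ → ⊥-elim (α∉ (from (truth α v) α∈v))) , to (truth β v) ]′ (h v wRv)
      from′ : w ∋ α ⇒ β → ‖ model ‖ (α ⇒ β) w
      from′ α⇒β∈w v wRv with em {‖ model ‖ α v}
      ... | yes α∈ = inj₂ (from (truth β v) (to (⇒∈⇔ α β w) α⇒β∈w v wRv (to (truth α v) α∈)))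
      ... | no α∉  = inj₁ α∉

  ◇□◇⁻¹-singleton : ∀ w u → (∀ {φ} → u ∋ φ → ¬ w ∋ ¬ᶠ φ) → ◇ (□ (◇⁻¹ ｛ u ｝)) w
  ◇□◇⁻¹-singleton w u consistent no-v =
    let (v , wRv , u⊆v) = successor-above w u consistent
    in no-v v wRv (λ x vRx → u , refl , R-antitone {w = u} {u = v} {v = x} u⊆v vRx)

  pseudo-symmetric : PseudoSymmetric
  pseudo-symmetric u w uRw = ◇□◇⁻¹-singleton w u consistent
    where
      consistent : ∀ {φ} → u ∋ φ → ¬ w ∋ ¬ᶠ φ
      consistent {φ} φ∈u ¬φ∈w
        with uRw ([ (¬ᶠ φ , fbot) ] , IsTheory.closed (theory u) (¬¬I φ ∙ ∨R₁ _ _) φ∈u , refl)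
                 (λ { (here refl) → ¬φ∈w ; (there ()) })
      ... | _ , here refl , ⊥∈w = IsTheory.⊥-nonmem (theory w) ⊥∈w

  pseudo-reflexive : (∀ α → α ∧ᶠ ¬ᶠ α ⊢ fbot) → PseudoReflexive
  pseudo-reflexive absurd w =
    inj₂ (◇□◇⁻¹-singleton w w λ φ∈w ¬φ∈w → ⊥-nonmem (closed (absurd _) (∧-closed φ∈w ¬φ∈w)))
    where open IsTheory (theory w)

canonical-inClass : (em : ExcludedMiddle 0ℓ) (k : K) → InClass k (Canonical.model em k)
canonical-inClass em k₁ = pseudo-reflexive Abs , pseudo-symmetric
  where open Canonical em k₁
canonical-inClass em k₂ = reflexive , pseudo-symmetric
  where
    open Canonical em k₂
    reflexive : FrameOps.Reflexive R
    reflexive w (ps , ∈w , refl) Δ⊆w = axioms w (mk ps) λ { (here refl) → ∈w ; (there φ∈) → Δ⊆w φ∈ }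

theorem3 : ExcludedMiddle 0ℓ → (k : K) (Γ : Form → Set) (φ : Form) → Γ ⊨[ k ] φ → Γ ⊢ˢ[ k ] φ
theorem3 em k Γ φ Γ⊨φ = dne λ Γ⊬φ → refute (countermodel-world Γ φ Γ⊬φ)
  where
    open Canonical em k
    open Equivalence
    refute : ¬ Σ World λ w → (∀ γ → Γ γ → w ∋ γ) × ¬ w ∋ φ
    refute (w , Γ⊆w , φ∉w) =
      φ∉w (to (truth φ w) (Γ⊨φ model (canonical-inClass em k) w λ γ γ∈Γ → from (truth γ w) (Γ⊆w γ γ∈Γ)))
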